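{- Let $G$ be a graph with no isolated vertices and at least one edge, and let $\mathcal{C}$ be a minimum edge clique cover of $G$ consisting of maximal cliques. Suppose that $\mathcal{C}$ contains a subfamily $\mathcal{F}$ with exactly $\theta_e(G)-k(G)+1$ elements such that the subgraph $H$ of $G$ formed by the edges covered by members of $\mathcal{F}$ (together with their end vertices) has at least $\theta_e(G)-k(G)$ simplicial vertices. Then $\mathcal{C}$ is an effective competition cover of $G$.
   Context: All graphs are finite and simple; digraphs are finite, without loops or multiple arcs. A clique is a vertex set inducing a complete subgraph; it covers an edge if it contains both ends. A vertex is simplicial in $H$ if its neighborhood in $H$ is a clique. The competition graph $C(D)$ of a digraph $D$ has vertex set $V(D)$, and distinct $x,y$ are adjacent iff some $z$ has arcs $(x,z),(y,z)$ in $D$. The competition number $k(G)$ is the smallest $k\ge0$ such that $G$ together with $k$ new isolated vertices is the competition graph of an acyclic digraph. An edge clique cover is a family of cliques covering all edges; $\theta_e(G)$ is the minimum size of one; a minimum edge clique cover has size $\theta_e(G)$. For $G$ with at least one edge, a minimum edge clique cover $\mathcal{C}=\{C_1,\dots,C_{\theta_e(G)}\}$ is an effective competition cover if every $C_i$ is a maximal clique and there is an acyclic digraph $D$ whose competition graph is $G$ together with $k(G)$ isolated vertices, such that the set of vertices of nonzero in-degree of $D$ is $\{w_1,\dots,w_{\theta_e(G)}\}$ where each $w_i$ is a common out-neighbor of all vertices of $C_i$. -}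

module Defs where

open import Data.Nat using (ℕ; _+_; _<_)
open import Data.Fin using (Fin)
open import Data.Fin.Subset using (Subset; _∈_; _∉_; _⊆_)
open import Data.Bool using (Bool; true; false; T)
open import Data.Sum using (_⊎_; inj₁; inj₂)
open import Data.Product using (Σ; ∃; ∃-syntax; _×_; _,_)
open import Data.Empty using (⊥)
open import Function.Definitions using (Injective)
open import Relation.Nullary using (¬_)
open import Relation.Binary.PropositionalEquality using (_≡_; _≢_)
open import Relation.Binary.Construct.Closure.Transitive using (TransClosure)

record Graph (n : ℕ) : Set where
  field
    adj     : Fin n → Fin n → Bool
    adj-sym : ∀ x y → adj x y ≡ adj y x
    adj-irr : ∀ x → adj x x ≡ false

open Graph public

Edge : ∀ {n} → Graph n → Fin n → Fin n → Set
Edge G x y = T (adj G x y)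

HasEdge : ∀ {n} → Graph n → Set
HasEdge G = ∃[ x ] ∃[ y ] Edge G x y

NoIsolated : ∀ {n} → Graph n → Set
NoIsolated G = ∀ x → ∃[ y ] Edge G x y

IsClique : ∀ {n} → Graph n → Subset n → Set
IsClique G S = ∀ x y → x ∈ S → y ∈ S → x ≢ y → Edge G x y

IsMaximalClique : ∀ {n} → Graph n → Subset n → Set
IsMaximalClique G S = IsClique G S × (∀ S′ → IsClique G S′ → S ⊆ S′ → S′ ⊆ S)

IsEdgeCliqueCover : ∀ {n} → Graph n → (t : ℕ) → (Fin t → Subset n) → Set
IsEdgeCliqueCover G t C =
  (∀ i → IsClique G (C i)) ×
  (∀ x y → Edge G x y → ∃[ i ] (x ∈ C i × y ∈ C i))

IsThetaE : ∀ {n} → Graph n → ℕ → Set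
IsThetaE {n} G θ =
  (Σ (Fin θ → Subset n) (IsEdgeCliqueCover G θ)) ×
  (∀ t → t < θ → ¬ Σ (Fin t → Subset n) (IsEdgeCliqueCover G t))

Digraph : Set → Set
Digraph V = V → V → Bool

Arc : ∀ {V} → Digraph V → V → V → Set
Arc D x y = T (D x y)

Acyclic : ∀ {V} → Digraph V → Set
Acyclic D = ∀ x → ¬ TransClosure (Arc D) x x

AdjPlusIso : ∀ {n} → Graph n → (k : ℕ) → Fin n ⊎ Fin k → Fin n ⊎ Fin k → Set
AdjPlusIso G k (inj₁ x) (inj₁ y) = Edge G x y
AdjPlusIso G k (inj₁ x) (inj₂ _) = ⊥
AdjPlusIso G k (inj₂ _) _        = ⊥

CompetitionGraphIs : ∀ {n} → (G : Graph n) → (k : ℕ) → Digraph (Fin n ⊎ Fin k) → Set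
CompetitionGraphIs G k D =
  ∀ x y → x ≢ y →
    ((∃[ z ] (Arc D x z × Arc D y z)) → AdjPlusIso G k x y) ×
    (AdjPlusIso G k x y → ∃[ z ] (Arc D x z × Arc D y z))

Realizes : ∀ {n} → Graph n → ℕ → Set
Realizes {n} G k = Σ (Digraph (Fin n ⊎ Fin k)) λ D → Acyclic D × CompetitionGraphIs G k D

IsCompetitionNumber : ∀ {n} → Graph n → ℕ → Set
IsCompetitionNumber G k = Realizes G k × (∀ k′ → k′ < k → ¬ Realizes G k′)

-- Effective competition cover (given θ = θ_e(G), k = k(G))

IsEffectiveCompetitionCover :
  ∀ {n} → (G : Graph n) → (θ k : ℕ) → (Fin θ → Subset n) → Set
IsEffectiveCompetitionCover {n} G θ k C =
  IsEdgeCliqueCover G θ C ×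
  (∀ i → IsMaximalClique G (C i)) ×
  Σ (Digraph (Fin n ⊎ Fin k)) λ D →
    Acyclic D × CompetitionGraphIs G k D ×
    Σ (Fin θ → Fin n ⊎ Fin k) λ w →
      (∀ v → ((∃[ u ] Arc D u v) → ∃[ i ] w i ≡ v) ×
             ((∃[ i ] w i ≡ v) → ∃[ u ] Arc D u v)) ×
      (∀ i x → x ∈ C i → Arc D (inj₁ x) (w i))

EdgeH : ∀ {n m} → Graph n → (Fin m → Subset n) → Fin n → Fin n → Set
EdgeH G F x y = Edge G x y × ∃[ j ] (x ∈ F j × y ∈ F j)

VertexH : ∀ {n m} → Graph n → (Fin m → Subset n) → Fin n → Set
VertexH G F v = ∃[ u ] EdgeH G F v u

SimplicialH : ∀ {n m} → Graph n → (Fin m → Subset n) → Fin n → Set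
SimplicialH G F v =
  VertexH G F v ×
  (∀ x y → EdgeH G F v x → EdgeH G F v y → x ≢ y → EdgeH G F x y)

module Submission where

-- Proof idea (Proposition 2.6).  Write θ = s + k, where s is the number of
-- simplicial vertices g₀,…,g_{s-1} of H and F = C ∘ f has s + 1 members.
--
-- * Since the members of a minimum cover are distinct maximal cliques, a
--   simplicial vertex of H lies in exactly one member of F, its "home".
-- * A pure counting argument on Fin (s+1) assigns to every g_j its own
--   member σ j of F such that the home of g_j' is σ j only if j' < j.
--   Using g_j as the common prey of the clique f (σ j), and the k new
--   isolated vertices as prey of the remaining k cliques, gives an injective
--   sink map w : Fin θ → V(G) ⊎ Fin k.
-- * For any injective sink map, the digraph with arcs x → w i (x ∈ C i) has
--   G plus k isolated vertices as competition graph and exactly the sinks as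
--   vertices of positive in-degree; it is acyclic as soon as some rank
--   strictly increases from each x ∈ C i to w i.  Rank g_j by j + 1, other
--   vertices of G by 0 and the new vertices by s + 1.
--
-- The construction
-- only uses θ = s + k.

open import Defs
open import Data.Nat using (ℕ; _+_)
open import Data.Fin using (Fin)
open import Data.Fin.Subset using (Subset)
open import Data.Product using (Σ; _×_)
open import Function.Definitions using (Injective)
open import Relation.Binary.PropositionalEquality using (_≡_)

open import Data.Nat as ℕ using (zero; suc; z≤n; s≤s)
open import Data.Nat.Properties using (n<1+n; <-trans; <-irrefl; +-comm; +-cancelʳ-≡)
open import Data.Fin as Fin using (zero; suc; toℕ; punchIn; punchOut; _≟_)
open import Data.Fin.Properties
  using (toℕ<n; punchIn-injective; punchInᵢ≢i; punchOut-cong′; punchOut-cong; punchOut-injective;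
         punchIn-punchOut; punchOut-punchIn; injective⇒≤; ¬∀⟶∃¬; any?; 0≢1+n; suc-injective)
open import Data.Fin.Subset using (_∈_; _⊆_; _∪_; ⁅_⁆)
open import Data.Fin.Subset.Properties
  using (_∈?_; nonempty?; ⊆-antisym; x∈⁅x⁆; x∈⁅y⁆⇒x≡y; p⊆p∪q; q⊆p∪q; x∈p∪q⁻)
open import Data.Product using (_,_; proj₁; proj₂; ∃-syntax)
open import Data.Sum using (_⊎_; inj₁; inj₂; map₁)
open import Data.Sum.Properties using (inj₁-injective; inj₂-injective; ≡-dec)
open import Data.Bool using (false)
open import Data.Empty using (⊥-elim)
open import Relation.Nullary using (¬_; Dec; yes; no)
open import Relation.Nullary.Decidable using (_×-dec_; isYes; toWitness; fromWitness)
open import Relation.Binary.PropositionalEquality using (refl; sym; trans; cong; subst; _≢_)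
open import Relation.Binary.Construct.Closure.Transitive using (TransClosure; [_]; _∷_)
open import Function using (_∘_)

-- No map Fin s → Fin (s + 1) is onto: a choice of preimages would be an
-- injection Fin (s + 1) → Fin s.
missedPoint : ∀ {s} (φ : Fin s → Fin (suc s)) → ∃[ u ] (∀ j → φ j ≢ u)
missedPoint {s} φ
  with ¬∀⟶∃¬ (suc s) (λ u → ∃[ j ] φ j ≡ u) (λ u → any? (λ j → φ j ≟ u)) notOnto
  where
  notOnto : ¬ (∀ u → ∃[ j ] φ j ≡ u)
  notOnto onto = <-irrefl refl (injective⇒≤ preimage-injective)
    where
    preimage-injective : Injective _≡_ _≡_ (λ u → proj₁ (onto u))
    preimage-injective {u} {u′} e =
      trans (sym (proj₂ (onto u))) (trans (cong φ e) (proj₂ (onto u′)))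
... | u , unhit = u , λ j e → unhit (j , e)

-- Take σ 0 to be a point missed by φ
-- and recurse on the remaining indices with that point punched out.
staggeredInjection : ∀ {s} (φ : Fin s → Fin (suc s)) →
  Σ (Fin s → Fin (suc s)) λ σ →
    Injective _≡_ _≡_ σ × (∀ j j′ → φ j′ ≡ σ j → j′ Fin.< j)
staggeredInjection {zero} φ = (λ ()) , (λ { {()} }) , λ ()
staggeredInjection {suc s} φ with missedPoint φ
... | u , missed with staggeredInjection (λ j → punchOut (missed (suc j) ∘ sym))
... | σ⁻ , σ⁻-injective , σ⁻-staggered = σ , σ-injective , σ-staggered
  where
  σ : Fin (suc s) → Fin (suc (suc s))
  σ zero    = u
  σ (suc j) = punchIn u (σ⁻ j)

  σ-injective : Injective _≡_ _≡_ σ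
  σ-injective {zero}  {zero}  _ = refl
  σ-injective {zero}  {suc j} e = ⊥-elim (punchInᵢ≢i u (σ⁻ j) (sym e))
  σ-injective {suc j} {zero}  e = ⊥-elim (punchInᵢ≢i u (σ⁻ j) e)
  σ-injective {suc j} {suc j′} e = cong suc (σ⁻-injective (punchIn-injective u _ _ e))

  σ-staggered : ∀ j j′ → φ j′ ≡ σ j → j′ Fin.< j
  σ-staggered zero    j′       e = ⊥-elim (missed j′ e)
  σ-staggered (suc j) zero     _ = s≤s z≤n
  σ-staggered (suc j) (suc j′) e =
    s≤s (σ⁻-staggered j j′ (trans (punchOut-cong′ u e) (punchOut-punchIn u)))

dropFirst : ∀ {s t} (σ : Fin (suc s) → Fin (suc t)) → Injective _≡_ _≡_ σ →
  Σ (Fin s → Fin t) λ σ⁻ →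
    Injective _≡_ _≡_ σ⁻ × (∀ j → punchIn (σ zero) (σ⁻ j) ≡ σ (suc j))
dropFirst {s} {t} σ σ-injective = σ⁻ , σ⁻-injective , λ j → punchIn-punchOut (avoids j)
  where
  avoids : ∀ j → σ zero ≢ σ (suc j)
  avoids j e = 0≢1+n (σ-injective e)

  σ⁻ : Fin s → Fin t
  σ⁻ j = punchOut (avoids j)

  σ⁻-injective : Injective _≡_ _≡_ σ⁻
  σ⁻-injective e = suc-injective (σ-injective (punchOut-injective (avoids _) (avoids _) e))

extendInjection : ∀ {s k} (σ : Fin s → Fin (s + k)) → Injective _≡_ _≡_ σ →
  Σ (Fin (s + k) → Fin s ⊎ Fin k) λ c →
    Injective _≡_ _≡_ c × (∀ j → c (σ j) ≡ inj₁ j)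
extendInjection {zero} σ _ = inj₂ , inj₂-injective , λ ()
extendInjection {suc s} {k} σ σ-injective with dropFirst σ σ-injective
... | σ⁻ , σ⁻-injective , σ⁻-lifts with extendInjection {s} {k} σ⁻ σ⁻-injective
... | c⁻ , c⁻-injective , c⁻-inverts = c , c-injective , c-inverts
  where
  shift : Fin s ⊎ Fin k → Fin (suc s) ⊎ Fin k
  shift = map₁ suc

  shift-injective : ∀ {t t′} → shift t ≡ shift t′ → t ≡ t′
  shift-injective {inj₁ _} {inj₁ _} refl = refl
  shift-injective {inj₂ _} {inj₂ _} refl = refl

  shift≢zero : ∀ t → shift t ≢ inj₁ zero
  shift≢zero (inj₁ _) ()
  shift≢zero (inj₂ _) ()

  c : Fin (suc (s + k)) → Fin (suc s) ⊎ Fin k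
  c i with i ≟ σ zero
  ... | yes _   = inj₁ zero
  ... | no i≢σ₀ = shift (c⁻ (punchOut (i≢σ₀ ∘ sym)))

  c-injective : Injective _≡_ _≡_ c
  c-injective {i} {i′} with i ≟ σ zero | i′ ≟ σ zero
  ... | yes p | yes q = λ _ → trans p (sym q)
  ... | yes _ | no q  = λ e → ⊥-elim (shift≢zero (c⁻ (punchOut (q ∘ sym))) (sym e))
  ... | no p  | yes _ = λ e → ⊥-elim (shift≢zero (c⁻ (punchOut (p ∘ sym))) e)
  ... | no p  | no q  = λ e →
    punchOut-injective (p ∘ sym) (q ∘ sym) (c⁻-injective (shift-injective e))

  c-inverts : ∀ j → c (σ j) ≡ inj₁ j
  c-inverts zero with σ zero ≟ σ zero
  ... | yes _ = refl
  ... | no p  = ⊥-elim (p refl)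
  c-inverts (suc j) with σ (suc j) ≟ σ zero
  ... | yes e = ⊥-elim (0≢1+n (σ-injective (sym e)))
  ... | no _  = cong shift (trans (cong c⁻ punchOut-σ) (c⁻-inverts j))
    where
    punchOut-σ : ∀ {p : σ zero ≢ σ (suc j)} → punchOut p ≡ σ⁻ j
    punchOut-σ = trans (punchOut-cong (σ zero) (sym (σ⁻-lifts j))) (punchOut-punchIn (σ zero))

rank⇒acyclic : ∀ {V : Set} (D : Digraph V) (rank : V → ℕ) →
  (∀ {u z} → Arc D u z → rank u ℕ.< rank z) → Acyclic D
rank⇒acyclic D rank increases x cycle = <-irrefl refl (along cycle)
  where
  along : ∀ {u z} → TransClosure (Arc D) u z → rank u ℕ.< rank z
  along [ a ]      = increases a
  along (a ∷ path) = <-trans (increases a) (along path)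

-- In a graph with at least one vertex every maximal clique is nonempty,
-- since otherwise it would be properly contained in a singleton clique.
maximalClique-nonempty : ∀ {n} {G : Graph n} {S : Subset n} →
  Fin n → IsMaximalClique G S → ∃[ x ] x ∈ S
maximalClique-nonempty {G = G} {S = S} x₀ (_ , maximal) with nonempty? S
... | yes inhabited = inhabited
... | no empty =
  x₀ , maximal ⁅ x₀ ⁆ singleton-clique (λ x∈S → ⊥-elim (empty (_ , x∈S))) (x∈⁅x⁆ x₀)
  where
  singleton-clique : IsClique G ⁅ x₀ ⁆
  singleton-clique x y x∈ y∈ x≢y =
    ⊥-elim (x≢y (trans (x∈⁅y⁆⇒x≡y x₀ x∈) (sym (x∈⁅y⁆⇒x≡y x₀ y∈))))

-- No member of a minimum edge clique cover lies inside another member: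
-- dropping it would leave a smaller cover.
minimumCover-unnested : ∀ {n θ} {G : Graph n} {C : Fin θ → Subset n} →
  IsThetaE G θ → IsEdgeCliqueCover G θ C → ∀ {i i′} → i ≢ i′ → ¬ (C i′ ⊆ C i)
minimumCover-unnested {θ = zero} _ _ {()}
minimumCover-unnested {n} {suc t} {G} {C} (_ , minimal) (cliques , covers) {i} {i′} i≢i′ nested =
  minimal t (n<1+n t) (C ∘ punchIn i′ , cliques ∘ punchIn i′ , covers′)
  where
  survives : ∀ {x y} j → j ≢ i′ → x ∈ C j → y ∈ C j →
    ∃[ l ] (x ∈ C (punchIn i′ l) × y ∈ C (punchIn i′ l))
  survives j j≢i′ x∈ y∈ = punchOut (j≢i′ ∘ sym) , subst (_ ∈_) same x∈ , subst (_ ∈_) same y∈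
    where
    same : C j ≡ C (punchIn i′ (punchOut (j≢i′ ∘ sym)))
    same = cong C (sym (punchIn-punchOut (j≢i′ ∘ sym)))

  covers′ : ∀ x y → Edge G x y → ∃[ l ] (x ∈ C (punchIn i′ l) × y ∈ C (punchIn i′ l))
  covers′ x y e with covers x y e
  ... | i₀ , x∈ , y∈ with i₀ ≟ i′
  ... | yes refl   = survives i i≢i′ (nested x∈) (nested y∈)
  ... | no i₀≢i′   = survives i₀ i₀≢i′ x∈ y∈

minimumCover-injective : ∀ {n θ} {G : Graph n} {C : Fin θ → Subset n} →
  IsThetaE G θ → IsEdgeCliqueCover G θ C → Injective _≡_ _≡_ C
minimumCover-injective {G = G} {C = C} minimum cover {i} {i′} Ci≡Ci′ with i ≟ i′
... | yes i≡i′ = i≡i′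
... | no i≢i′  = ⊥-elim (minimumCover-unnested {G = G} minimum cover i≢i′ (subst (λ S → _ ∈ S) (sym Ci≡Ci′)))

module _ {n m} {G : Graph n} {F : Fin m → Subset n}
         (maximal : ∀ l → IsMaximalClique G (F l))
         {v : Fin n} (simplicial : SimplicialH G F v) where

  private
    clique : ∀ l → IsClique G (F l)
    clique l = proj₁ (maximal l)

  -- Two members of F through v span a clique of G: vertices other than v
  -- are H-neighbours of v, hence adjacent by simpliciality.
  simplicial-cross-edge : ∀ {la lb} → v ∈ F la → v ∈ F lb →
    ∀ {x y} → x ∈ F la → y ∈ F lb → x ≢ y → Edge G x y
  simplicial-cross-edge {la} {lb} v∈a v∈b {x} {y} x∈a y∈b x≢y with x ≟ v | y ≟ v
  ... | yes refl | _        = clique lb x y v∈b y∈b x≢y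
  ... | no _     | yes refl = clique la x y x∈a v∈a x≢y
  ... | no x≢v   | no y≢v   = proj₁ (proj₂ simplicial x y v~x v~y x≢y)
    where
    v~x : EdgeH G F v x
    v~x = clique la v x v∈a x∈a (x≢v ∘ sym) , la , v∈a , x∈a
    v~y : EdgeH G F v y
    v~y = clique lb v y v∈b y∈b (y≢v ∘ sym) , lb , v∈b , y∈b

  simplicial-union-clique : ∀ {la lb} → v ∈ F la → v ∈ F lb → IsClique G (F la ∪ F lb)
  simplicial-union-clique {la} {lb} v∈a v∈b x y x∈ y∈ x≢y
    with x∈p∪q⁻ (F la) (F lb) x∈ | x∈p∪q⁻ (F la) (F lb) y∈
  ... | inj₁ x∈a | inj₁ y∈a = clique la x y x∈a y∈a x≢y
  ... | inj₂ x∈b | inj₂ y∈b = clique lb x y x∈b y∈b x≢y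
  ... | inj₁ x∈a | inj₂ y∈b = simplicial-cross-edge v∈a v∈b x∈a y∈b x≢y
  ... | inj₂ x∈b | inj₁ y∈a = simplicial-cross-edge v∈b v∈a x∈b y∈a x≢y

  -- By maximality both members equal their union.
  simplicial-members-equal : ∀ {la lb} → v ∈ F la → v ∈ F lb → F la ≡ F lb
  simplicial-members-equal {la} {lb} v∈a v∈b = ⊆-antisym (inside v∈b v∈a) (inside v∈a v∈b)
    where
    inside : ∀ {l l′} → v ∈ F l′ → v ∈ F l → F l ⊆ F l′
    inside {l} {l′} v∈l′ v∈l x∈l =
      proj₂ (maximal l′) (F l′ ∪ F l) (simplicial-union-clique v∈l′ v∈l) (p⊆p∪q (F l))
        (q⊆p∪q (F l′) (F l) x∈l)

module CoverDigraph {n θ k} (G : Graph n) (C : Fin θ → Subset n)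
                    (w : Fin θ → Fin n ⊎ Fin k) where

  Feeds : Fin n → Fin n ⊎ Fin k → Set
  Feeds x z = ∃[ i ] (x ∈ C i × w i ≡ z)

  feeds? : ∀ x z → Dec (Feeds x z)
  feeds? x z = any? (λ i → (x ∈? C i) ×-dec ≡-dec _≟_ _≟_ (w i) z)

  D : Digraph (Fin n ⊎ Fin k)
  D (inj₁ x) z = isYes (feeds? x z)
  D (inj₂ _) _ = false

  arc⇒feeds : ∀ {x z} → Arc D (inj₁ x) z → Feeds x z
  arc⇒feeds {x} {z} = toWitness {a? = feeds? x z}

  member⇒arc : ∀ i x → x ∈ C i → Arc D (inj₁ x) (w i)
  member⇒arc i x x∈ = fromWitness {a? = feeds? x (w i)} (i , x∈ , refl)

  acyclic : (rank : Fin n ⊎ Fin k → ℕ) →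
    (∀ i x → x ∈ C i → rank (inj₁ x) ℕ.< rank (w i)) → Acyclic D
  acyclic rank increases = rank⇒acyclic D rank increases-along-arc
    where
    increases-along-arc : ∀ {u z} → Arc D u z → rank u ℕ.< rank z
    increases-along-arc {inj₁ x} a with arc⇒feeds a
    ... | i , x∈ , refl = increases i x x∈

  -- For an injective w, two vertices share a prey iff they share a member.
  competition : IsEdgeCliqueCover G θ C → Injective _≡_ _≡_ w → CompetitionGraphIs G k D
  competition (cliques , covers) w-injective x y x≢y = common⇒adjacent x y x≢y , adjacent⇒common x y
    where
    common⇒adjacent : ∀ x y → x ≢ y → ∃[ z ] (Arc D x z × Arc D y z) → AdjPlusIso G k x y
    common⇒adjacent (inj₁ a) (inj₁ b) a≢b (z , a→z , b→z)
      with arc⇒feeds a→z | arc⇒feeds b→z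
    ... | i , a∈ , refl | i′ , b∈ , wi′≡wi with w-injective wi′≡wi
    ... | refl = cliques i a b a∈ b∈ (a≢b ∘ cong inj₁)
    adjacent⇒common : ∀ x y → AdjPlusIso G k x y → ∃[ z ] (Arc D x z × Arc D y z)
    adjacent⇒common (inj₁ a) (inj₁ b) a~b with covers a b a~b
    ... | i , a∈ , b∈ = w i , member⇒arc i a a∈ , member⇒arc i b b∈

  in-degree : (∀ i → ∃[ x ] x ∈ C i) →
    ∀ z → ((∃[ u ] Arc D u z) → ∃[ i ] w i ≡ z) × ((∃[ i ] w i ≡ z) → ∃[ u ] Arc D u z)
  in-degree nonempty z = has-prey , is-prey
    where
    has-prey : (∃[ u ] Arc D u z) → ∃[ i ] w i ≡ z
    has-prey (inj₁ x , a) with arc⇒feeds a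
    ... | i , _ , wi≡z = i , wi≡z
    is-prey : (∃[ i ] w i ≡ z) → ∃[ u ] Arc D u z
    is-prey (i , refl) with nonempty i
    ... | x , x∈ = inj₁ x , member⇒arc i x x∈

sinks⇒effectiveCover : ∀ {n θ k} (G : Graph n) (C : Fin θ → Subset n) →
  HasEdge G → IsEdgeCliqueCover G θ C → (∀ i → IsMaximalClique G (C i)) →
  (w : Fin θ → Fin n ⊎ Fin k) → Injective _≡_ _≡_ w →
  (rank : Fin n ⊎ Fin k → ℕ) → (∀ i x → x ∈ C i → rank (inj₁ x) ℕ.< rank (w i)) →
  IsEffectiveCompetitionCover G θ k C
sinks⇒effectiveCover G C (x₀ , _) cover maximal w w-injective rank increases =
  cover , maximal , D , acyclic rank increases , competition cover w-injective ,
  w , in-degree (λ i → maximalClique-nonempty {G = G} x₀ (maximal i)) , member⇒arc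
  where open CoverDigraph G C w

module SimplicialSinks {n s k} (G : Graph n) (C : Fin (s + k) → Subset n)
  (minimum : IsThetaE G (s + k)) (cover : IsEdgeCliqueCover G (s + k) C)
  (maximal : ∀ i → IsMaximalClique G (C i))
  (f : Fin (suc s) → Fin (s + k)) (f-injective : Injective _≡_ _≡_ f)
  (g : Fin s → Fin n) (g-injective : Injective _≡_ _≡_ g)
  (simplicial : ∀ j → SimplicialH G (C ∘ f) (g j)) where

  F : Fin (suc s) → Subset n
  F = C ∘ f

  F-injective : Injective _≡_ _≡_ F
  F-injective = f-injective ∘ minimumCover-injective {G = G} minimum cover

  homeMember : ∀ j → Σ (Fin (suc s)) λ l → g j ∈ F l
  homeMember j with proj₁ (simplicial j)
  ... | _ , _ , l , g∈ , _ = l , g∈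

  home : Fin s → Fin (suc s)
  home = proj₁ ∘ homeMember

  home-unique : ∀ {j l} → g j ∈ F l → home j ≡ l
  home-unique {j} g∈ =
    F-injective (simplicial-members-equal {G = G} {F = F} (maximal ∘ f) (simplicial j)
                   (proj₂ (homeMember j)) g∈)

  -- g j will be the sink of the member σ j of F
  staggered : Σ (Fin s → Fin (suc s)) λ σ →
    Injective _≡_ _≡_ σ × (∀ j j′ → home j′ ≡ σ j → j′ Fin.< j)
  staggered = staggeredInjection home

  σ : Fin s → Fin (suc s)
  σ = proj₁ staggered

  σ-staggered : ∀ j j′ → home j′ ≡ σ j → j′ Fin.< j
  σ-staggered = proj₂ (proj₂ staggered)

  -- the other k members of C get the k new vertices as sinks
  extension : Σ (Fin (s + k) → Fin s ⊎ Fin k) λ c →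
    Injective _≡_ _≡_ c × (∀ j → c (f (σ j)) ≡ inj₁ j)
  extension = extendInjection (f ∘ σ) (proj₁ (proj₂ staggered) ∘ f-injective)

  sinkOf : Fin (s + k) → Fin s ⊎ Fin k
  sinkOf = proj₁ extension

  sinkOf-injective : Injective _≡_ _≡_ sinkOf
  sinkOf-injective = proj₁ (proj₂ extension)

  sinkOf-σ : ∀ j → sinkOf (f (σ j)) ≡ inj₁ j
  sinkOf-σ = proj₂ (proj₂ extension)

  vertex : Fin s ⊎ Fin k → Fin n ⊎ Fin k
  vertex (inj₁ j) = inj₁ (g j)
  vertex (inj₂ t) = inj₂ t

  w : Fin (s + k) → Fin n ⊎ Fin k
  w = vertex ∘ sinkOf

  w-injective : Injective _≡_ _≡_ w
  w-injective = sinkOf-injective ∘ vertex-injective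
    where
    vertex-injective : ∀ {t t′} → vertex t ≡ vertex t′ → t ≡ t′
    vertex-injective {inj₁ _} {inj₁ _} e = cong inj₁ (g-injective (inj₁-injective e))
    vertex-injective {inj₂ _} {inj₂ _} e = cong inj₂ (inj₂-injective e)

  rank : Fin n ⊎ Fin k → ℕ
  rank (inj₁ x) with any? (λ j → g j ≟ x)
  ... | yes (j , _) = suc (toℕ j)
  ... | no _        = 0
  rank (inj₂ _) = suc s

  rank-bounded : ∀ x → rank (inj₁ x) ℕ.≤ s
  rank-bounded x with any? (λ j → g j ≟ x)
  ... | yes (j , _) = toℕ<n j
  ... | no _        = z≤n

  rank-sink : ∀ j → rank (inj₁ (g j)) ≡ suc (toℕ j)
  rank-sink j with any? (λ j′ → g j′ ≟ g j)
  ... | yes (j′ , e) = cong (suc ∘ toℕ) (g-injective e)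
  ... | no none      = ⊥-elim (none (j , refl))

  -- A simplicial vertex in the member σ j has that member as its home,
  -- so it comes before g j.
  rank-below-sink : ∀ j x → x ∈ F (σ j) → rank (inj₁ x) ℕ.< suc (toℕ j)
  rank-below-sink j x x∈ with any? (λ j′ → g j′ ≟ x)
  ... | yes (j′ , refl) = s≤s (σ-staggered j j′ (home-unique x∈))
  ... | no _            = s≤s z≤n

  rank-increases : ∀ i x → x ∈ C i → rank (inj₁ x) ℕ.< rank (w i)
  rank-increases i x x∈ with sinkOf i in sinkOf-i
  ... | inj₂ _ = s≤s (rank-bounded x)
  ... | inj₁ j with sinkOf-injective (trans sinkOf-i (sym (sinkOf-σ j)))
  ... | refl = subst (rank (inj₁ x) ℕ.<_) (sym (rank-sink j)) (rank-below-sink j x x∈)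

simplicialSinks⇒effectiveCover : ∀ {n s k} (G : Graph n) (C : Fin (s + k) → Subset n) →
  HasEdge G → IsThetaE G (s + k) →
  IsEdgeCliqueCover G (s + k) C → (∀ i → IsMaximalClique G (C i)) →
  (f : Fin (suc s) → Fin (s + k)) → Injective _≡_ _≡_ f →
  (g : Fin s → Fin n) → Injective _≡_ _≡_ g →
  (∀ j → SimplicialH G (C ∘ f) (g j)) →
  IsEffectiveCompetitionCover G (s + k) k C
simplicialSinks⇒effectiveCover G C hasEdge minimum cover maximal f f-injective g g-injective simplicial =
  sinks⇒effectiveCover G C hasEdge cover maximal w w-injective rank rank-increases
  where open SimplicialSinks G C minimum cover maximal f f-injective g g-injective simplicial

proposition2p6 : ∀ {n} (G : Graph n) (θ k : ℕ) (C : Fin θ → Subset n) →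
    NoIsolated G → HasEdge G →
    IsThetaE G θ → IsCompetitionNumber G k →
    IsEdgeCliqueCover G θ C → (∀ i → IsMaximalClique G (C i)) →
    (m : ℕ) → m + k ≡ θ + 1 →
    (f : Fin m → Fin θ) → Injective _≡_ _≡_ f →
    (s : ℕ) → s + k ≡ θ →
    (g : Fin s → Fin n) → Injective _≡_ _≡_ g →
    (∀ j → SimplicialH G (λ l → C (f l)) (g j)) →
    IsEffectiveCompetitionCover G θ k C
proposition2p6 G .(s + k) k C _ hasEdge minimum _ cover maximal m m+k≡θ+1 f f-injective s refl g g-injective simplicial
  with refl ← +-cancelʳ-≡ k m (suc s) (trans m+k≡θ+1 (+-comm (s + k) 1)) =
  simplicialSinks⇒effectiveCover G C hasEdge minimum cover maximal f f-injective g g-injective simplicial
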